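{- Let $G,H$ be impartial games with $\mathbf N\notin o(H)$. Then $o(G+H)\subseteq o(G)$.
   Context: All games are short impartial games (identified with the finite set of their options, no infinite runs); $G+H$ is the disjunctive sum. There are $N\ge 2$ players moving cyclically; under normal play the player unable to move on their turn is the unique loser. Relative to a position, the players are $\mathbf N=\mathbf O_0$ (next to move), $\mathbf O_1,\dots,\mathbf O_{N-2}$, $\mathbf P=\mathbf O_{N-1}$, where $\mathbf O_i$ moves $i$ turns after $\mathbf N$. The outcome $o(G)\subseteq\{\mathbf O_0,\dots,\mathbf O_{N-1}\}$ is defined recursively: $\mathbf N\in o(G)$ iff some option $G'$ has $\mathbf P\in o(G')$; for $1\le i\le N-1$, $\mathbf O_i\in o(G)$ iff every option $G'$ has $\mathbf O_{i-1}\in o(G')$. -}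

module Defs where

open import Data.Nat using (ℕ; zero; suc)
open import Data.Fin using (Fin; zero; suc; fromℕ; inject₁)
open import Data.List using (List; []; _∷_; _++_)
open import Data.Empty using (⊥)
open import Data.Unit using (⊤)
open import Data.Sum using (_⊎_)
open import Data.Product using (_×_)

data Game : Set where
  mk : List Game → Game

options : Game → List Game
options (mk gs) = gs

mutual
  _⊕_ : Game → Game → Game
  mk gs ⊕ mk hs = mk (leftOpts gs hs ++ rightOpts gs hs)

  leftOpts : List Game → List Game → List Game
  leftOpts [] hs = []
  leftOpts (g ∷ gs) hs = (g ⊕ mk hs) ∷ leftOpts gs hs

  rightOpts : List Game → List Game → List Game
  rightOpts gs [] = []
  rightOpts gs (h ∷ hs) = (mk gs ⊕ h) ∷ rightOpts gs hs

infixl 6 _⊕_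

-- Outcome membership with N players; players are Fin N, where
-- zero = N (= O_0), suc i = O_{i+1}, and fromℕ m = P = O_{N-1} when N = suc m.
-- In G i  means  O_i ∈ o(G).
mutual
  In : {N : ℕ} → Game → Fin N → Set
  In {suc m} (mk gs) zero = AnyIn (fromℕ m) gs
  In {suc m} (mk gs) (suc i) = AllIn (inject₁ i) gs

  AnyIn : {N : ℕ} → Fin N → List Game → Set
  AnyIn i [] = ⊥
  AnyIn i (g ∷ gs) = In g i ⊎ AnyIn i gs

  AllIn : {N : ℕ} → Fin N → List Game → Set
  AllIn i [] = ⊤
  AllIn i (g ∷ gs) = In g i × AllIn i gs

_⊆o_ : {N : ℕ} → Game → Game → Set
_⊆o_ {N} G H = (i : Fin N) → In G i → In H i

module Submission where

-- The proof is one simultaneous induction on G + H with two statements: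
--   * absorb   : N ∉ o(H) ⇒ o(G + H) ⊆ o(G);
--   * transfer : O_j ∈ o(G + K) and O_j ∉ o(K) ⇒ N ∈ o(G).
-- For absorb, an outcome O_{i+1} of G + H passes to G through the options
-- G' + H; the outcome N passes through a winning option G' + H by induction,
-- or, if the winning option is G + H', through transfer applied to P and H'
-- (H' ∉ P because N ∉ o(H)).  For transfer with j = 0 we use absorb; for
-- j = i+1 some option K' of K lacks O_i (outcomes are decidable), while
-- G + K' has O_i, and we recurse on K'.  The recursions over lists of
-- options are written out so that the induction is structural.

open import Defs
open import Data.Nat using (ℕ; suc; _≤_)
open import Data.Fin using (Fin; zero; suc; fromℕ; inject₁)
open import Data.List using (List; []; _∷_; _++_)
open import Data.Unit using (tt)
open import Data.Empty using (⊥-elim)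
open import Data.Sum using (_⊎_; inj₁; inj₂)
open import Data.Product using (_×_; _,_; proj₁; proj₂)
open import Function using (_∘_)
open import Relation.Nullary using (¬_; Dec; yes; no)
open import Relation.Nullary.Decidable using (_⊎-dec_; _×-dec_)

anyIn-++ : {N : ℕ} {i : Fin N} (xs ys : List Game) →
  AnyIn i (xs ++ ys) → AnyIn i xs ⊎ AnyIn i ys
anyIn-++ []       ys p        = inj₂ p
anyIn-++ (x ∷ xs) ys (inj₁ p) = inj₁ (inj₁ p)
anyIn-++ (x ∷ xs) ys (inj₂ p) with anyIn-++ xs ys p
... | inj₁ q = inj₁ (inj₂ q)
... | inj₂ q = inj₂ q

allIn-++ : {N : ℕ} {i : Fin N} (xs ys : List Game) →
  AllIn i (xs ++ ys) → AllIn i xs × AllIn i ys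
allIn-++ []       ys p       = tt , p
allIn-++ (x ∷ xs) ys (p , q) with allIn-++ xs ys q
... | l , r = (p , l) , r

-- Outcomes of short games are decidable; this is what lets transfer pick an
-- option K' of K lacking a given outcome.
mutual
  decIn : {N : ℕ} (G : Game) (i : Fin N) → Dec (In G i)
  decIn {suc m} (mk gs) zero    = decAnyIn (fromℕ m) gs
  decIn {suc m} (mk gs) (suc i) = decAllIn (inject₁ i) gs

  decAnyIn : {N : ℕ} (i : Fin N) (gs : List Game) → Dec (AnyIn i gs)
  decAnyIn i []       = no λ ()
  decAnyIn i (g ∷ gs) = decIn g i ⊎-dec decAnyIn i gs

  decAllIn : {N : ℕ} (i : Fin N) (gs : List Game) → Dec (AllIn i gs)
  decAllIn i []       = yes tt
  decAllIn i (g ∷ gs) = decIn g i ×-dec decAllIn i gs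

module Absorption (n : ℕ) where

  P : Fin (suc n)
  P = fromℕ n

  NextWins : Game → Set
  NextWins G = In {suc n} G zero

  mutual
    absorb : (G H : Game) → ¬ NextWins H → (i : Fin (suc n)) → In (G ⊕ H) i → In G i
    absorb (mk gs) (mk hs) H∌N zero win
      with anyIn-++ (leftOpts gs hs) (rightOpts gs hs) win
    ... | inj₁ viaLeft  = absorbAny gs hs H∌N viaLeft
    ... | inj₂ viaRight = absorbRight gs hs H∌N viaRight
    absorb (mk gs) (mk hs) H∌N (suc i) allWin =
      absorbAll gs hs H∌N (inject₁ i) (proj₁ (allIn-++ (leftOpts gs hs) (rightOpts gs hs) allWin))

    absorbAny : (gs hs : List Game) → ¬ NextWins (mk hs) →
      AnyIn P (leftOpts gs hs) → AnyIn P gs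
    absorbAny (g ∷ gs) hs H∌N (inj₁ p) = inj₁ (absorb g (mk hs) H∌N P p)
    absorbAny (g ∷ gs) hs H∌N (inj₂ p) = inj₂ (absorbAny gs hs H∌N p)

    absorbAll : (gs hs : List Game) → ¬ NextWins (mk hs) → (i : Fin (suc n)) →
      AllIn i (leftOpts gs hs) → AllIn i gs
    absorbAll []       hs H∌N i tt      = tt
    absorbAll (g ∷ gs) hs H∌N i (p , q) = absorb g (mk hs) H∌N i p , absorbAll gs hs H∌N i q

    absorbRight : (gs hs : List Game) → ¬ AnyIn P hs →
      AnyIn P (rightOpts gs hs) → NextWins (mk gs)
    absorbRight gs (h ∷ hs) hs∌P (inj₁ p) = transfer P (mk gs) h p (hs∌P ∘ inj₁)
    absorbRight gs (h ∷ hs) hs∌P (inj₂ p) = absorbRight gs hs (hs∌P ∘ inj₂) p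

    transfer : (j : Fin (suc n)) (G K : Game) → In (G ⊕ K) j → ¬ In K j → NextWins G
    transfer zero    G       K       p K∌N = absorb G K K∌N zero p
    transfer (suc j) (mk gs) (mk ks) p ks∌j =
      transferRight (inject₁ j) gs ks (proj₂ (allIn-++ (leftOpts gs ks) (rightOpts gs ks) p)) ks∌j

    transferRight : (j : Fin (suc n)) (gs ks : List Game) →
      AllIn j (rightOpts gs ks) → ¬ AllIn j ks → NextWins (mk gs)
    transferRight j gs []       tt      ks∌j = ⊥-elim (ks∌j tt)
    transferRight j gs (k ∷ ks) (p , q) ks∌j with decIn k j
    ... | yes k∋j = transferRight j gs ks q (ks∌j ∘ (k∋j ,_))
    ... | no  k∌j = transfer j (mk gs) k p k∌j

-- The theorem for N = suc m players; absorption holds for every N ≥ 1.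
mainTheorem4 : (m : ℕ) → 1 ≤ m → (G H : Game) →
    ¬ In {suc m} H zero → _⊆o_ {suc m} (G ⊕ H) G
mainTheorem4 m _ G H H∌N = Absorption.absorb m G H H∌N
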